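{- For every integer $n>24$, the generalized Petersen graph $GP(n,4)$ is not $1$-distance-balanced.
   Context: For $n\ge 3$ and $1\le k<n/2$, the generalized Petersen graph $GP(n,k)$ has vertex set $\{u_i: i\in\mathbb{Z}_n\}\cup\{v_i: i\in\mathbb{Z}_n\}$ and edge set $\{u_iu_{i+1}\}\cup\{v_iv_{i+k}\}\cup\{u_iv_i\}$ ($i\in\mathbb{Z}_n$). For vertices $x,y$ of a connected graph $G$, $W_{xy}=\{w\in V(G): d_G(w,x)<d_G(w,y)\}$. $G$ is $\ell$-distance-balanced (for $1\le\ell\le{\rm diam}(G)$) if $|W_{xy}|=|W_{yx}|$ for all $x,y$ with $d_G(x,y)=\ell$. -}

module Defs where

open import Data.Nat using (ℕ; zero; suc; _+_; _≤_; _<_)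
open import Data.Fin using (Fin; toℕ)
open import Data.Fin.Subset using (Subset; _∈_; ∣_∣)
open import Data.Product using (_×_; ∃; ∃₂; Σ-syntax)
open import Data.Sum using (_⊎_)
open import Function.Bundles using (_⇔_)
open import Relation.Binary.PropositionalEquality using (_≡_)

data Vertex (n : ℕ) : Set where
  u : Fin n → Vertex n
  v : Fin n → Vertex n

-- Step n s i j  :  j ≡ i + s (mod n), for i j ∈ {0..n-1} and s < n.
Step : (n s : ℕ) → Fin n → Fin n → Set
Step n s i j = (toℕ i + s ≡ toℕ j) ⊎ (toℕ i + s ≡ toℕ j + n)

data Adj (n k : ℕ) : Vertex n → Vertex n → Set where
  outer  : ∀ {i j} → Step n 1 i j → Adj n k (u i) (u j)
  outer' : ∀ {i j} → Step n 1 j i → Adj n k (u i) (u j)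
  inner  : ∀ {i j} → Step n k i j → Adj n k (v i) (v j)
  inner' : ∀ {i j} → Step n k j i → Adj n k (v i) (v j)
  spoke  : ∀ {i} → Adj n k (u i) (v i)
  spoke' : ∀ {i} → Adj n k (v i) (u i)

data Walk (n k : ℕ) : Vertex n → Vertex n → ℕ → Set where
  [] : ∀ {x} → Walk n k x x zero
  _∷_ : ∀ {x y z m} → Adj n k x y → Walk n k y z m → Walk n k x z (suc m)

Dist : (n k : ℕ) → Vertex n → Vertex n → ℕ → Set
Dist n k x y m = Walk n k x y m × (∀ l → Walk n k x y l → m ≤ l)

W : (n k : ℕ) → Vertex n → Vertex n → Vertex n → Set
W n k x y w = ∃₂ λ a b → Dist n k w x a × Dist n k w y b × a < b

HasCard : (n : ℕ) → (Vertex n → Set) → ℕ → Set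
HasCard n P c =
  Σ[ Su ∈ Subset n ] Σ[ Sv ∈ Subset n ]
    (∀ i → (i ∈ Su) ⇔ P (u i)) × (∀ i → (i ∈ Sv) ⇔ P (v i)) × (∣ Su ∣ + ∣ Sv ∣ ≡ c)

DistanceBalanced : (n k ℓ : ℕ) → Set
DistanceBalanced n k ℓ =
  ∀ x y → Dist n k x y ℓ →
  ∀ a b → HasCard n (W n k x y) a → HasCard n (W n k y x) b → a ≡ b

-- Look at the edge u₀v₀ of GP(n,4), n ≥ 25. A 1-Lipschitz potential φ with φ(u₀) = 0 bounds d(w,u₀)
-- from below, and explicit walks bound d(w,v₀) from above. Comparing them, no outer vertex u_a with
-- 3 ≤ a ≤ n − 3 is closer to u₀, every u_a with 4 ≤ a ≤ n − 4 is closer to v₀, and so are the seven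
-- inner vertices v₀, v_{±4}, v_{±8}, v_{±12}. If s ≥ 7 inner vertices are closer to v₀, then
-- |W_{u₀v₀}| ≤ 5 + (n − s) < (n − 7) + s ≤ |W_{v₀u₀}|.
module Submission where

open import Defs
open import Data.Nat using (ℕ; zero; suc; _+_; _*_; _∸_; _⊓_; _≤_; _<_; z≤n; s≤s; s≤s⁻¹; z<s; _≟_; _≤?_; _<?_)
open import Data.Nat.Properties
open import Relation.Nullary using (¬_)
open import Data.Empty using (⊥-elim)
open import Data.Fin as Fin using (Fin; toℕ; fromℕ<; opposite; #_)
open import Data.Fin.Properties as Finₚ using (any?; toℕ-injective; toℕ<n; toℕ-fromℕ<; opposite-prop)
open import Data.Fin.Subset as Sub using (Subset; ⁅_⁆; _∪_; ∁; ∣_∣; _∈_; _∉_; _⊆_; inside; outside)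
open import Data.Fin.Subset.Properties
  using (∣p∣≤∣x∷p∣; ∣⊥∣≡0; ∣⁅x⁆∣≡1; ∉⊥; x∈⁅x⁆; x∈⁅y⁆⇒x≡y; x∈p∪q⁺; x∈p∪q⁻; q⊆p∪q;
         p⊆q⇒∣p∣≤∣q∣; p⊂q⇒∣p∣<∣q∣; ∣p∣≤n; ∣∁p∣≡n∸∣p∣; x∉p⇒x∈∁p; x∈∁p⇒x∉p)
open import Data.Vec using ([]; _∷_; tabulate)
open import Data.Vec.Properties using (lookup∘tabulate; lookup⇒[]=; []=⇒lookup)
open import Data.List using (List; []; _∷_; _++_; length)
open import Data.List.Membership.Propositional using () renaming (_∈_ to _∈ₗ_)
open import Data.List.Membership.Propositional.Properties using (∈-++⁺ˡ; ∈-++⁺ʳ)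
open import Data.List.Relation.Unary.Any using (here; there)
open import Data.List.Relation.Unary.All as All using (All; []; _∷_)
open import Data.List.Relation.Unary.AllPairs as AllPairs using ([]; _∷_)
open import Data.List.Relation.Unary.Linked using (Linked; []; [-]; _∷_)
open import Data.List.Relation.Unary.Linked.Properties using (Linked⇒AllPairs)
open import Data.List.Relation.Unary.Unique.Propositional using (Unique)
open import Data.Product using (_×_; _,_; ∃; proj₁; proj₂)
open import Data.Sum using (_⊎_; inj₁; inj₂; [_,_]′)
open import Function using (_∘_; _$_)
open import Function.Bundles using (mk⇔)
open import Relation.Binary.Definitions using (DecidableEquality) renaming (Decidable to Decidable₂)
open import Relation.Binary.PropositionalEquality
  using (_≡_; _≢_; refl; sym; trans; cong; subst; subst₂; module ≡-Reasoning)
open import Relation.Nullary.Decidable as Dec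
  using (Dec; yes; no; does; _⊎-dec_; _×-dec_; from-yes; True; toWitness)
open import Relation.Unary using (Pred; Decidable)

module _ {n k : ℕ} where

  _≟ᵛ_ : DecidableEquality (Vertex n)
  u i ≟ᵛ u j = Dec.map′ (cong u) (λ { refl → refl }) (i Fin.≟ j)
  u _ ≟ᵛ v _ = no λ ()
  v _ ≟ᵛ u _ = no λ ()
  v i ≟ᵛ v j = Dec.map′ (cong v) (λ { refl → refl }) (i Fin.≟ j)

  step? : ∀ s → Decidable₂ (Step n s)
  step? s i j = (toℕ i + s ≟ toℕ j) ⊎-dec (toℕ i + s ≟ toℕ j + n)

  adj? : Decidable₂ (Adj n k)
  adj? (u i) (u j) = Dec.map′ [ outer , outer' ]′ (λ { (outer s) → inj₁ s ; (outer' s) → inj₂ s })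
                              (step? 1 i j ⊎-dec step? 1 j i)
  adj? (u i) (v j) = Dec.map′ (λ { refl → spoke }) (λ { spoke → refl }) (i Fin.≟ j)
  adj? (v i) (u j) = Dec.map′ (λ { refl → spoke' }) (λ { spoke' → refl }) (i Fin.≟ j)
  adj? (v i) (v j) = Dec.map′ [ inner , inner' ]′ (λ { (inner s) → inj₁ s ; (inner' s) → inj₂ s })
                              (step? k i j ⊎-dec step? k j i)

  walk? : ∀ m x z → Dec (Walk n k x z m)
  walk? zero x z = Dec.map′ (λ { refl → [] }) (λ { [] → refl }) (x ≟ᵛ z)
  walk? (suc m) x z =
    Dec.map′ [ extend ∘ proj₂ , extend ∘ proj₂ ]′ split (any? (via? ∘ u) ⊎-dec any? (via? ∘ v))
    where
    Via : Vertex n → Set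
    Via y = Adj n k x y × Walk n k y z m
    via? : ∀ y → Dec (Via y)
    via? y = adj? x y ×-dec walk? m y z
    extend : ∀ {y} → Via y → Walk n k x z (suc m)
    extend (e , w) = e ∷ w
    split : Walk n k x z (suc m) → (∃ λ i → Via (u i)) ⊎ (∃ λ i → Via (v i))
    split (_∷_ {y = u i} e w) = inj₁ (i , e , w)
    split (_∷_ {y = v i} e w) = inj₂ (i , e , w)

  private
    least-walk : ∀ x z l → (∃ λ a → Dist n k x z a) ⊎ (∀ m → m < l → ¬ Walk n k x z m)
    least-walk x z zero = inj₂ λ _ ()
    least-walk x z (suc l) with least-walk x z l | walk? l x z
    ... | inj₁ d    | _     = inj₁ d
    ... | inj₂ none | yes w = inj₁ (l , w , λ m w′ → ≮⇒≥ λ m<l → none m m<l w′)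
    ... | inj₂ none | no ¬w = inj₂ λ m m<1+l →
      [ none m , (λ { refl → ¬w }) ]′ (m<1+n⇒m<n∨m≡n m<1+l)

  shortest : ∀ {x z L} → Walk n k x z L → ∃ λ a → Dist n k x z a × a ≤ L
  shortest {x} {z} {L} w with least-walk x z (suc L)
  ... | inj₁ (a , d) = a , d , proj₂ d L w
  ... | inj₂ none    = ⊥-elim (none L ≤-refl w)

  Dist-unique : ∀ {x z a b} → Dist n k x z a → Dist n k x z b → a ≡ b
  Dist-unique (wa , minA) (wb , minB) = ≤-antisym (minA _ wb) (minB _ wa)

  _∷ʳ_ : ∀ {x y z m} → Walk n k x y m → Adj n k y z → Walk n k x z (suc m)
  []      ∷ʳ e = e ∷ []
  (d ∷ w) ∷ʳ e = d ∷ (w ∷ʳ e)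

  W-asym : ∀ {x y w} → W n k x y w → ¬ W n k y x w
  W-asym (a , b , da , db , a<b) (b′ , a′ , db′ , da′ , b′<a′) =
    <-asym a<b (subst₂ _<_ (Dist-unique db′ db) (Dist-unique da′ da) b′<a′)

  W? : ∀ {x y w L M} → Walk n k w x L → Walk n k w y M → Dec (W n k x y w)
  W? {x} {y} {w} p q with shortest p | shortest q
  ... | a , da , _ | b , db , _ = Dec.map′ (λ a<b → a , b , da , db , a<b) closer (a <? b)
    where
    closer : W n k x y w → a < b
    closer (a′ , b′ , da′ , db′ , a′<b′) = subst₂ _<_ (Dist-unique da′ da) (Dist-unique db′ db) a′<b′

  OneLipschitz : (Vertex n → ℕ) → Set
  OneLipschitz φ = ∀ {x y} → Adj n k x y → φ x ≤ suc (φ y)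

  Lipschitz-walk : ∀ {φ} → OneLipschitz φ → ∀ {x z l} → Walk n k x z l → φ x ≤ l + φ z
  Lipschitz-walk lip []      = ≤-refl
  Lipschitz-walk lip (e ∷ w) = ≤-trans (lip e) (s≤s (Lipschitz-walk lip w))

  module _ {φ : Vertex n → ℕ} (lip : OneLipschitz φ) {x : Vertex n} (φx≡0 : φ x ≡ 0) where

    ≤-walk-length : ∀ {w l} → Walk n k w x l → φ w ≤ l
    ≤-walk-length {l = l} p = subst (_ ≤_) (trans (cong (l +_) φx≡0) (+-identityʳ l)) (Lipschitz-walk lip p)

    ∈W-by-potential : ∀ {w y L M} → Walk n k w y L → Walk n k w x M → L < φ w → W n k y x w
    ∈W-by-potential p q L<φ with shortest p | shortest q
    ... | a , da , a≤L | b , db , _ =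
      a , b , da , db , ≤-<-trans a≤L (<-≤-trans L<φ (≤-walk-length (proj₁ db)))

    ∉W-by-potential : ∀ {w y L} → Walk n k w y L → L ≤ φ w → ¬ W n k x y w
    ∉W-by-potential p L≤φ (a , b , da , db , a<b) =
      <-irrefl refl (<-≤-trans a<b (≤-trans (proj₂ db _ p) (≤-trans L≤φ (≤-walk-length (proj₁ da)))))

∣p∪q∣≤∣p∣+∣q∣ : ∀ {n} (p q : Subset n) → ∣ p ∪ q ∣ ≤ ∣ p ∣ + ∣ q ∣
∣p∪q∣≤∣p∣+∣q∣ []            []            = z≤n
∣p∪q∣≤∣p∣+∣q∣ (inside  ∷ p) (x ∷ q)       =
  s≤s (≤-trans (∣p∪q∣≤∣p∣+∣q∣ p q) (+-monoʳ-≤ ∣ p ∣ (∣p∣≤∣x∷p∣ x q)))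
∣p∪q∣≤∣p∣+∣q∣ (outside ∷ p) (inside  ∷ q) =
  ≤-trans (s≤s (∣p∪q∣≤∣p∣+∣q∣ p q)) (≤-reflexive (sym (+-suc ∣ p ∣ ∣ q ∣)))
∣p∪q∣≤∣p∣+∣q∣ (outside ∷ p) (outside ∷ q) = ∣p∪q∣≤∣p∣+∣q∣ p q

disjoint⇒∣p∣+∣q∣≤n : ∀ {n} {p q : Subset n} → (∀ {i} → i ∈ p → i ∉ q) → ∣ p ∣ + ∣ q ∣ ≤ n
disjoint⇒∣p∣+∣q∣≤n {n} {p} {q} disjoint =
  m≤o∸n⇒m+n≤o ∣ p ∣ (∣p∣≤n q) $ begin
    ∣ p ∣     ≤⟨ p⊆q⇒∣p∣≤∣q∣ (x∉p⇒x∈∁p ∘ disjoint) ⟩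
    ∣ ∁ q ∣   ≡⟨ ∣∁p∣≡n∸∣p∣ q ⟩
    n ∸ ∣ q ∣ ∎
  where open ≤-Reasoning

module _ {n : ℕ} where

  select : ∀ {ℓ} {P : Pred (Fin n) ℓ} → Decidable P → Subset n
  select P? = tabulate (does ∘ P?)

  ∈-select⁺ : ∀ {ℓ} {P : Pred (Fin n) ℓ} (P? : Decidable P) {i} → P i → i ∈ select P?
  ∈-select⁺ P? {i} p =
    lookup⇒[]= i (select P?) (trans (lookup∘tabulate (does ∘ P?) i) (Dec.dec-true (P? i) p))

  ∈-select⁻ : ∀ {ℓ} {P : Pred (Fin n) ℓ} (P? : Decidable P) {i} → i ∈ select P? → P i
  ∈-select⁻ P? {i} i∈ with P? i | trans (sym (lookup∘tabulate (does ∘ P?) i)) ([]=⇒lookup i∈)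
  ... | yes p | _ = p

  hasCard : ∀ {P : Vertex n → Set} (P? : Decidable P) →
            HasCard n P (∣ select (P? ∘ u) ∣ + ∣ select (P? ∘ v) ∣)
  hasCard P? =
    select (P? ∘ u) , select (P? ∘ v) ,
    (λ _ → mk⇔ (∈-select⁻ (P? ∘ u)) (∈-select⁺ (P? ∘ u))) ,
    (λ _ → mk⇔ (∈-select⁻ (P? ∘ v)) (∈-select⁺ (P? ∘ v))) , refl

  fromList : List (Fin n) → Subset n
  fromList []       = Sub.⊥
  fromList (i ∷ is) = ⁅ i ⁆ ∪ fromList is

  ∈-fromList⁺ : ∀ {i is} → i ∈ₗ is → i ∈ fromList is
  ∈-fromList⁺ {is = j ∷ _}  (here refl) = x∈p∪q⁺ (inj₁ (x∈⁅x⁆ j))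
  ∈-fromList⁺               (there i∈)  = x∈p∪q⁺ (inj₂ (∈-fromList⁺ i∈))

  ∈-fromList⁻ : ∀ {i} is → i ∈ fromList is → i ∈ₗ is
  ∈-fromList⁻ []       i∈ = ⊥-elim (∉⊥ i∈)
  ∈-fromList⁻ (j ∷ is) i∈ =
    [ here ∘ x∈⁅y⁆⇒x≡y j , there ∘ ∈-fromList⁻ is ]′ (x∈p∪q⁻ ⁅ j ⁆ (fromList is) i∈)

  ∣fromList∣≤length : ∀ is → ∣ fromList is ∣ ≤ length is
  ∣fromList∣≤length []       = ≤-reflexive (∣⊥∣≡0 n)
  ∣fromList∣≤length (i ∷ is) = begin
    ∣ ⁅ i ⁆ ∪ fromList is ∣         ≤⟨ ∣p∪q∣≤∣p∣+∣q∣ ⁅ i ⁆ (fromList is) ⟩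
    ∣ ⁅ i ⁆ ∣ + ∣ fromList is ∣     ≡⟨ cong (_+ ∣ fromList is ∣) (∣⁅x⁆∣≡1 i) ⟩
    suc ∣ fromList is ∣             ≤⟨ s≤s (∣fromList∣≤length is) ⟩
    suc (length is)                 ∎
    where open ≤-Reasoning

  length≤∣fromList∣ : ∀ {is} → Unique is → length is ≤ ∣ fromList is ∣
  length≤∣fromList∣ []                        = z≤n
  length≤∣fromList∣ {i ∷ is} (i∉is ∷ unique) =
    ≤-trans (s≤s (length≤∣fromList∣ unique))
            (p⊂q⇒∣p∣<∣q∣ (q⊆p∪q ⁅ i ⁆ _ , i , x∈p∪q⁺ (inj₁ (x∈⁅x⁆ i)) , i∉fromList))
    where
    i∉fromList : i ∉ fromList is
    i∉fromList i∈ = All.lookup i∉is (∈-fromList⁻ is i∈) refl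

Near : ℕ → ℕ → Set
Near p q = p ≤ suc q × q ≤ suc p

Near-sym : ∀ {p q} → Near p q → Near q p
Near-sym (p≤ , q≤) = q≤ , p≤

Near-suc : ∀ {p q} → Near p q → Near (suc p) (suc q)
Near-suc (p≤ , q≤) = s≤s p≤ , s≤s q≤

Near-⊓ : ∀ {p q r s} → Near p r → Near q s → Near (p ⊓ q) (r ⊓ s)
Near-⊓ (p≤ , r≤) (q≤ , s≤) = ⊓-mono-≤ p≤ q≤ , ⊓-mono-≤ r≤ s≤

Near-1+ : ∀ p → Near p (suc p)
Near-1+ p = m≤n⇒m≤1+n (n≤1+n p) , ≤-refl

Near-refl : ∀ p → Near p p
Near-refl p = n≤1+n p , n≤1+n p

Near-≤1 : ∀ {p q} → p ≤ 1 → q ≤ 1 → Near p q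
Near-≤1 p≤1 q≤1 = ≤-trans p≤1 (s≤s z≤n) , ≤-trans q≤1 (s≤s z≤n)

-- 1 + μ a is the length of the walk from u_a to v₀ that moves along the outer cycle from a = 4q + r
-- down to 4q (or up to 4q + 4 when r = 3), takes the spoke, and then q or q + 1 inner edges.
μ : ℕ → ℕ
μ 0 = 0
μ 1 = 1
μ 2 = 2
μ 3 = 2
μ (suc (suc (suc (suc a)))) = suc (μ a)

μ-near-suc : ∀ a → Near (μ a) (μ (suc a))
μ-near-suc 0 = Near-1+ 0
μ-near-suc 1 = Near-1+ 1
μ-near-suc 2 = Near-refl 2
μ-near-suc 3 = Near-sym (Near-1+ 1)
μ-near-suc (suc (suc (suc (suc a)))) = Near-suc (μ-near-suc a)

μ-near-reflect : ∀ {c b} → c + b ≡ 4 → Near (μ c) (μ b)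
μ-near-reflect {0} refl = Near-1+ 0
μ-near-reflect {1} refl = Near-1+ 1
μ-near-reflect {2} refl = Near-refl 2
μ-near-reflect {3} refl = Near-sym (Near-1+ 1)
μ-near-reflect {4} refl = Near-sym (Near-1+ 0)

μ≤id : ∀ a → μ a ≤ a
μ≤id 0 = z≤n
μ≤id 1 = ≤-refl
μ≤id 2 = ≤-refl
μ≤id 3 = n≤1+n 2
μ≤id (suc (suc (suc (suc a)))) = s≤s (≤-trans (μ≤id a) (m≤n+m a 3))

1+μ≤id : ∀ {a} → 3 ≤ a → suc (μ a) ≤ a
1+μ≤id {1} (s≤s ())
1+μ≤id {2} (s≤s (s≤s ()))
1+μ≤id {3} _ = ≤-refl
1+μ≤id {suc (suc (suc (suc a)))} _ = s≤s (s≤s (≤-trans (μ≤id a) (m≤n+m a 2)))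

2+μ≤id : ∀ {a} → 4 ≤ a → 2 + μ a ≤ a
2+μ≤id {1} (s≤s ())
2+μ≤id {2} (s≤s (s≤s ()))
2+μ≤id {3} (s≤s (s≤s (s≤s ())))
2+μ≤id {suc (suc (suc (suc a)))} _ = s≤s (s≤s (s≤s (≤-trans (μ≤id a) (n≤1+n a))))

μ-lower : ∀ t {a} → t * 4 ≤ a → t ≤ μ a
μ-lower zero    _ = z≤n
μ-lower (suc t) {suc (suc (suc (suc a)))} (s≤s (s≤s (s≤s (s≤s t*4≤a)))) = s≤s (μ-lower t t*4≤a)

μ≤2 : ∀ {a} → a ≤ 4 → μ a ≤ 2
μ≤2 {0} _ = z≤n
μ≤2 {1} _ = n≤1+n 1
μ≤2 {2} _ = ≤-refl
μ≤2 {3} _ = ≤-refl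
μ≤2 {4} _ = n≤1+n 1
μ≤2 {suc (suc (suc (suc (suc _))))} (s≤s (s≤s (s≤s (s≤s ()))))

μ-small≤μ-large : ∀ {c d} → c ≤ 4 → 12 ≤ d → μ c ≤ μ d
μ-small≤μ-large c≤4 12≤d = ≤-trans (μ≤2 c≤4) (≤-trans (n≤1+n 2) (μ-lower 3 12≤d))

-- Evaluated at a and n ∸ a, the lengths of the two outer arcs between u_a and u₀, these define a
-- 1-Lipschitz function on GP(n,4) vanishing at u₀ (φ below).
φᵤ φᵥ : ℕ → ℕ → ℕ
φᵤ a b = (a ⊓ b) ⊓ suc (suc (μ a ⊓ μ b))
φᵥ a b = suc (μ a ⊓ μ b)

φᵤ≤ˡ : ∀ a b → φᵤ a b ≤ a
φᵤ≤ˡ a b = ≤-trans (m⊓n≤m _ _) (m⊓n≤m a b)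

φᵤ≤ʳ : ∀ a b → φᵤ a b ≤ b
φᵤ≤ʳ a b = ≤-trans (m⊓n≤m _ _) (m⊓n≤n a b)

φᵤ≤1+φᵥ : ∀ a b → φᵤ a b ≤ suc (φᵥ a b)
φᵤ≤1+φᵥ a b = m⊓n≤n _ _

φᵥ≤1+φᵤ : ∀ a b → φᵥ a b ≤ suc (φᵤ a b)
φᵥ≤1+φᵤ a b = s≤s (⊓-glb (⊓-mono-≤ (μ≤id a) (μ≤id b)) (≤-trans (n≤1+n _) (n≤1+n _)))

1+μ≤φᵤ : ∀ {a b} → 3 ≤ a → 3 ≤ b → suc (μ a ⊓ μ b) ≤ φᵤ a b
1+μ≤φᵤ 3≤a 3≤b = ⊓-glb (⊓-mono-≤ (1+μ≤id 3≤a) (1+μ≤id 3≤b)) (n≤1+n _)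

2+μ≤φᵤ : ∀ {a b} → 4 ≤ a → 4 ≤ b → 2 + (μ a ⊓ μ b) ≤ φᵤ a b
2+μ≤φᵤ 4≤a 4≤b = ⊓-glb (⊓-mono-≤ (2+μ≤id 4≤a) (2+μ≤id 4≤b)) ≤-refl

φᵤ-near : ∀ a b → Near (φᵤ a (suc b)) (φᵤ (suc a) b)
φᵤ-near a b = Near-⊓ (Near-⊓ (Near-1+ a) (Near-sym (Near-1+ b)))
                     (Near-suc (Near-suc (Near-⊓ (μ-near-suc a) (Near-sym (μ-near-suc b)))))

φᵥ-near : ∀ a b → Near (φᵥ a (4 + b)) (φᵥ (4 + a) b)
φᵥ-near a b = Near-suc (Near-⊓ (Near-1+ (μ a)) (Near-sym (Near-1+ (μ b))))

φᵤ-near-wrap : ∀ {a b c d} → c + b ≡ 1 → Near (φᵤ a c) (φᵤ b d)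
φᵤ-near-wrap {a} {b} {c} {d} c+b≡1 =
  Near-≤1 (≤-trans (φᵤ≤ʳ a c) (≤-trans (m≤m+n c b) (≤-reflexive c+b≡1)))
          (≤-trans (φᵤ≤ˡ b d) (≤-trans (m≤n+m b c) (≤-reflexive c+b≡1)))

φᵥ-near-wrap : ∀ {a b c d} → c + b ≡ 4 → 12 ≤ a → 12 ≤ d → Near (φᵥ a c) (φᵥ b d)
φᵥ-near-wrap {a} {b} {c} {d} c+b≡4 12≤a 12≤d =
  subst₂ Near (cong suc (sym (m≥n⇒m⊓n≡n (μ-small≤μ-large c≤4 12≤a))))
              (cong suc (sym (m≤n⇒m⊓n≡m (μ-small≤μ-large b≤4 12≤d))))
              (Near-suc (μ-near-reflect c+b≡4))
  where
  c≤4 = ≤-trans (m≤m+n c b) (≤-reflexive c+b≡4)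
  b≤4 = ≤-trans (m≤n+m b c) (≤-reflexive c+b≡4)

∸-shift : ∀ {a s c m} → a + s ≡ c → c ≤ m → m ∸ a ≡ s + (m ∸ c)
∸-shift {a} {s} {m = m} refl c≤m = begin
  m ∸ a                            ≡⟨ cong (_∸ a) (sym (m∸n+n≡m c≤m)) ⟩
  (m ∸ (a + s)) + (a + s) ∸ a      ≡⟨ +-∸-assoc (m ∸ (a + s)) (m≤m+n a s) ⟩
  (m ∸ (a + s)) + (a + s ∸ a)      ≡⟨ cong ((m ∸ (a + s)) +_) (m+n∸m≡n a s) ⟩
  (m ∸ (a + s)) + s                ≡⟨ +-comm _ s ⟩
  s + (m ∸ (a + s))                ∎
  where open ≡-Reasoning

wrap-index : ∀ {a s b m} → a + s ≡ b + m → a ≤ m → m ∸ a + b ≡ s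
wrap-index {a} {s} {b} {m} eq a≤m = +-cancelˡ-≡ a _ _ $ begin
  a + (m ∸ a + b)   ≡⟨ sym (+-assoc a (m ∸ a) b) ⟩
  a + (m ∸ a) + b   ≡⟨ cong (_+ b) (m+[n∸m]≡n a≤m) ⟩
  m + b             ≡⟨ +-comm m b ⟩
  b + m             ≡⟨ sym eq ⟩
  a + s             ∎
  where open ≡-Reasoning

module _ {n k : ℕ} {i j : Fin n} where

  outer-down : toℕ i ≡ suc (toℕ j) → Adj n k (u i) (u j)
  outer-down eq = outer' (inj₁ (trans (+-comm (toℕ j) 1) (sym eq)))

  outer-up : toℕ j ≡ suc (toℕ i) → Adj n k (u i) (u j)
  outer-up eq = outer (inj₁ (trans (+-comm (toℕ i) 1) (sym eq)))

  inner-down : toℕ i ≡ k + toℕ j → Adj n k (v i) (v j)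
  inner-down eq = inner' (inj₁ (trans (+-comm (toℕ j) k) (sym eq)))

  spoke-≡ : toℕ i ≡ toℕ j → Adj n k (u i) (v j)
  spoke-≡ eq with toℕ-injective eq
  ... | refl = spoke

module _ {n k : ℕ} where

  walk-shorter : ∀ {x z l m} → Walk n k x z l → Walk n k x z m → Walk n k x z (l ⊓ m)
  walk-shorter {x} {z} {l} {m} p q =
    [ (λ eq → subst (Walk n k x z) (sym eq) p) , (λ eq → subst (Walk n k x z) (sym eq) q) ]′ (⊓-sel l m)

  outer-walk-to-0 : ∀ a (i : Fin (suc n)) → toℕ i ≡ a → Walk (suc n) k (u i) (u Fin.zero) a
  outer-walk-to-0 zero    i i≡0 with toℕ-injective {j = Fin.zero} i≡0
  ... | refl = []
  outer-walk-to-0 (suc a) i i≡1+a =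
    outer-down (trans i≡1+a (cong suc (sym (toℕ-fromℕ< a<n))))
      ∷ outer-walk-to-0 a (fromℕ< a<n) (toℕ-fromℕ< a<n)
    where
    a<n : a < suc n
    a<n = <-trans (n<1+n a) (subst (_< suc n) i≡1+a (toℕ<n i))

  walk-to-u₀ : ∀ w → ∃ (Walk (suc n) k w (u Fin.zero))
  walk-to-u₀ (u i) = _ , outer-walk-to-0 _ i refl
  walk-to-u₀ (v i) = _ , spoke' ∷ outer-walk-to-0 _ i refl

  inner-walk-down : ∀ t (j : Fin (suc n)) → toℕ j ≡ t * k → Walk (suc n) k (v j) (v Fin.zero) t
  inner-walk-down zero    j j≡0 with toℕ-injective {j = Fin.zero} j≡0
  ... | refl = []
  inner-walk-down (suc t) j j≡ =
    inner-down (trans j≡ (cong (k +_) (sym (toℕ-fromℕ< b)))) ∷ inner-walk-down t (fromℕ< b) (toℕ-fromℕ< b)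
    where
    b : t * k < suc n
    b = ≤-<-trans (m≤n+m (t * k) k) (subst (_< suc n) j≡ (toℕ<n j))

module _ {n : ℕ} where

  inner-walk-up : ∀ t (j : Fin (suc n)) → toℕ j + suc t * 4 ≡ suc n →
                  Walk (suc n) 4 (v j) (v Fin.zero) (suc t)
  inner-walk-up zero    j j+4≡n = inner (inj₂ j+4≡n) ∷ []
  inner-walk-up (suc t) j j+s≡n =
    inner (inj₁ (sym (toℕ-fromℕ< b))) ∷ inner-walk-up t (fromℕ< b) j′+s≡n
    where
    b : toℕ j + 4 < suc n
    b = ≤-trans (+-monoʳ-< (toℕ j) (m<m+n 4 z<s)) (≤-reflexive j+s≡n)
    j′+s≡n : toℕ (fromℕ< b) + suc t * 4 ≡ suc n
    j′+s≡n = trans (cong (_+ suc t * 4) (toℕ-fromℕ< b)) (trans (+-assoc (toℕ j) 4 (suc t * 4)) j+s≡n)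

  walk-down : ∀ x c (i j : Fin n) → toℕ i ≡ x + c → toℕ j ≡ c → suc (x + c) < n →
              Walk n 4 (u i) (v j) (suc (μ x))
  walk-down 0 c i j i≡ j≡ _ = spoke-≡ (trans i≡ (sym j≡)) ∷ []
  walk-down 1 c i j i≡ j≡ _ = outer-down (trans i≡ (cong suc (sym j≡))) ∷ spoke ∷ []
  walk-down 2 c i j i≡ j≡ 3+c<n =
    outer-down (trans i≡ (cong suc (sym (toℕ-fromℕ< b))))
      ∷ outer-down (trans (toℕ-fromℕ< b) (cong suc (sym j≡))) ∷ spoke ∷ []
    where
    b : suc c < n
    b = <-trans (n<1+n (suc c)) (<-trans (n<1+n (2 + c)) 3+c<n)
  walk-down 3 c i j i≡ j≡ 4+c<n =
    outer-up (trans (toℕ-fromℕ< 4+c<n) (cong suc (sym i≡))) ∷ spoke ∷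
    inner-down (trans (toℕ-fromℕ< 4+c<n) (cong (4 +_) (sym j≡))) ∷ []
  walk-down (suc (suc (suc (suc x)))) c i j i≡ j≡ 5+x+c<n =
    walk-down x (4 + c) i (fromℕ< b) (trans i≡ 4+x+c≡x+[4+c]) (toℕ-fromℕ< b)
              (subst (λ t → suc t < n) 4+x+c≡x+[4+c] 5+x+c<n)
      ∷ʳ inner-down (trans (toℕ-fromℕ< b) (cong (4 +_) (sym j≡)))
    where
    4+x+c≡x+[4+c] : 4 + x + c ≡ x + (4 + c)
    4+x+c≡x+[4+c] = trans (cong (_+ c) (+-comm 4 x)) (+-assoc x 4 c)
    b : 4 + c < n
    b = ≤-<-trans (+-monoʳ-≤ 4 (m≤n+m c x)) (<-trans (n<1+n _) 5+x+c<n)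

  -- c ≤ n read modulo n.
  ReducesTo : ℕ → Fin n → Set
  ReducesTo c j = toℕ j ≡ c ⊎ (c ≡ n × toℕ j ≡ 0)

  step-to : ∀ s {i j} c → toℕ i + s ≡ c → ReducesTo c j → Step n s i j
  step-to s c i+s≡c (inj₁ j≡c)           = inj₁ (trans i+s≡c (sym j≡c))
  step-to s c i+s≡c (inj₂ (c≡n , j≡0)) = inj₂ (trans (trans i+s≡c c≡n) (cong (_+ n) (sym j≡0)))

  walk-up : ∀ y c (i j : Fin n) → toℕ i + y ≡ c → c ≤ n → 0 < toℕ i → ReducesTo c j →
            Walk n 4 (u i) (v j) (suc (μ y))
  walk-up 0 c i j i+0≡c _ _ (inj₁ j≡c) =
    spoke-≡ (trans (sym (+-identityʳ (toℕ i))) (trans i+0≡c (sym j≡c))) ∷ []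
  walk-up 0 c i j i+0≡c _ _ (inj₂ (c≡n , _)) =
    ⊥-elim (<-irrefl (trans (sym (+-identityʳ (toℕ i))) (trans i+0≡c c≡n)) (toℕ<n i))
  walk-up 1 c i j i+1≡c _ _ r = outer (step-to 1 c i+1≡c r) ∷ spoke ∷ []
  walk-up 2 c i j i+2≡c c≤n _ r =
    outer (inj₁ (sym (toℕ-fromℕ< b))) ∷ outer (step-to 1 c i′+1≡c r) ∷ spoke ∷ []
    where
    b : toℕ i + 1 < n
    b = ≤-trans (≤-reflexive (sym (+-suc (toℕ i) 1))) (≤-trans (≤-reflexive i+2≡c) c≤n)
    i′+1≡c : toℕ (fromℕ< b) + 1 ≡ c
    i′+1≡c = trans (cong (_+ 1) (toℕ-fromℕ< b)) (trans (+-assoc (toℕ i) 1 1) i+2≡c)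
  walk-up 3 c i j i+3≡c _ 0<i r with toℕ i in i≡
  ... | suc a =
    outer-down (trans i≡ (cong suc (sym (toℕ-fromℕ< a<n)))) ∷ spoke ∷ inner (step-to 4 c a′+4≡c r) ∷ []
    where
    a<n : a < n
    a<n = <-trans (n<1+n a) (subst (_< n) i≡ (toℕ<n i))
    a′+4≡c : toℕ (fromℕ< a<n) + 4 ≡ c
    a′+4≡c = trans (cong (_+ 4) (toℕ-fromℕ< a<n)) (trans (+-suc a 3) i+3≡c)
  walk-up (suc (suc (suc (suc y)))) c i j i+y+4≡c c≤n 0<i r =
    walk-up y (toℕ i + y) i m refl (<⇒≤ b) 0<i (inj₁ (toℕ-fromℕ< b)) ∷ʳ inner (step-to 4 c m+4≡c r)
    where
    b : toℕ i + y < n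
    b = <-≤-trans (+-monoʳ-< (toℕ i) (m<n+m y z<s)) (≤-trans (≤-reflexive i+y+4≡c) c≤n)
    m = fromℕ< b
    m+4≡c : toℕ m + 4 ≡ c
    m+4≡c = begin
      toℕ m + 4        ≡⟨ cong (_+ 4) (toℕ-fromℕ< b) ⟩
      toℕ i + y + 4    ≡⟨ +-assoc (toℕ i) y 4 ⟩
      toℕ i + (y + 4)  ≡⟨ cong (toℕ i +_) (+-comm y 4) ⟩
      toℕ i + (4 + y)  ≡⟨ i+y+4≡c ⟩
      c                ∎
      where open ≡-Reasoning

walk-to-v₀ : ∀ {n} (i : Fin (suc n)) → 0 < toℕ i → 2 + toℕ i ≤ suc n →
             Walk (suc n) 4 (u i) (v Fin.zero) (suc (μ (toℕ i) ⊓ μ (suc n ∸ toℕ i)))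
walk-to-v₀ {n} i 0<i 2+i≤n = walk-shorter
  (walk-down (toℕ i) 0 i Fin.zero (sym (+-identityʳ (toℕ i))) refl
             (subst (λ a → 2 + a ≤ suc n) (sym (+-identityʳ (toℕ i))) 2+i≤n))
  (walk-up (suc n ∸ toℕ i) (suc n) i Fin.zero (m+[n∸m]≡n (<⇒≤ (toℕ<n i))) ≤-refl 0<i
           (inj₂ (refl , refl)))

module _ {n : ℕ} where

  window : ∀ a r → a + r ≤ n → List (Fin n)
  window a zero    _       = []
  window a (suc r) a+1+r≤n =
    fromℕ< (<-≤-trans (m<m+n a z<s) a+1+r≤n) ∷ window (suc a) r (subst (_≤ n) (+-suc a r) a+1+r≤n)

  ∈-window : ∀ a r (a+r≤n : a + r ≤ n) {i} → a ≤ toℕ i → toℕ i < a + r → i ∈ₗ window a r a+r≤n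
  ∈-window a zero    _ {i} a≤i i<a+0 = ⊥-elim (<⇒≱ (subst (toℕ i <_) (+-identityʳ a) i<a+0) a≤i)
  ∈-window a (suc r) _ {i} a≤i i<a+1+r with a ≟ toℕ i
  ... | yes a≡i = here (toℕ-injective (trans (sym a≡i) (sym (toℕ-fromℕ< _))))
  ... | no  a≢i = there (∈-window (suc a) r _ (≤∧≢⇒< a≤i a≢i) (subst (toℕ i <_) (+-suc a r) i<a+1+r))

  rim : ∀ r → r < n → List (Fin n)
  rim r r<n = window 0 (suc r) r<n ++ window (n ∸ r) r (≤-reflexive (m∸n+n≡m (<⇒≤ r<n)))

  rim-or-interior : ∀ r (r<n : r < n) i → i ∈ₗ rim r r<n ⊎ (suc r ≤ toℕ i × suc r + toℕ i ≤ n)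
  rim-or-interior r r<n i with suc r ≤? toℕ i | suc r + toℕ i ≤? n
  ... | no  i≤r | _        = inj₁ (∈-++⁺ˡ (∈-window 0 (suc r) r<n z≤n (≰⇒> i≤r)))
  ... | yes r<i | yes fits = inj₂ (r<i , fits)
  ... | yes _   | no ¬fits =
    inj₁ (∈-++⁺ʳ (window 0 (suc r) r<n) (∈-window (n ∸ r) r _ n∸r≤i i<n∸r+r))
    where
    n∸r≤i : n ∸ r ≤ toℕ i
    n∸r≤i = m≤n+o⇒m∸n≤o n r (s≤s⁻¹ (≰⇒> ¬fits))
    i<n∸r+r : toℕ i < n ∸ r + r
    i<n∸r+r = subst (toℕ i <_) (sym (m∸n+n≡m (<⇒≤ r<n))) (toℕ<n i)

unbalanced : ∀ {A B C s m} → A ≤ 5 → B + s ≤ m → m ≤ 7 + C → 7 ≤ s → A + B ≢ C + s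
unbalanced {A} {B} {C} {s} {m} A≤5 B+s≤m m≤7+C 7≤s A+B≡C+s = <-irrefl refl $ begin-strict
  5 + m          <⟨ +-monoˡ-< m (from-yes (5 <? 7)) ⟩
  7 + m          ≡⟨ +-comm 7 m ⟩
  m + 7          ≤⟨ +-mono-≤ m≤7+C 7≤s ⟩
  7 + C + s      ≤⟨ +-monoˡ-≤ s (+-monoˡ-≤ C 7≤s) ⟩
  s + C + s      ≡⟨ cong (_+ s) (+-comm s C) ⟩
  C + s + s      ≡⟨ cong (_+ s) (sym A+B≡C+s) ⟩
  A + B + s      ≡⟨ +-assoc A B s ⟩
  A + (B + s)    ≤⟨ +-mono-≤ A≤5 B+s≤m ⟩
  5 + m          ∎
  where open ≤-Reasoning

module _ (e : ℕ) where

  -- n is written 25 + e so that comparisons of n with numerals are decided by evaluation.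
  private
    n : ℕ
    n = 25 + e

  φ : Vertex n → ℕ
  φ (u i) = φᵤ (toℕ i) (n ∸ toℕ i)
  φ (v i) = φᵥ (toℕ i) (n ∸ toℕ i)

  φ-near-outer : ∀ {i j} → Step n 1 i j → Near (φ (u i)) (φ (u j))
  φ-near-outer {i} {j} (inj₁ i+1≡j) =
    subst₂ (λ b a → Near (φᵤ (toℕ i) b) (φᵤ a (n ∸ toℕ j)))
      (sym (∸-shift {toℕ i} {1} i+1≡j (<⇒≤ (toℕ<n j)))) (trans (+-comm 1 (toℕ i)) i+1≡j)
      (φᵤ-near (toℕ i) (n ∸ toℕ j))
  φ-near-outer {i} {j} (inj₂ i+1≡j+n) = φᵤ-near-wrap (wrap-index i+1≡j+n (<⇒≤ (toℕ<n i)))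

  φ-near-inner : ∀ {i j} → Step n 4 i j → Near (φ (v i)) (φ (v j))
  φ-near-inner {i} {j} (inj₁ i+4≡j) =
    subst₂ (λ b a → Near (φᵥ (toℕ i) b) (φᵥ a (n ∸ toℕ j)))
      (sym (∸-shift {toℕ i} {4} i+4≡j (<⇒≤ (toℕ<n j)))) (trans (+-comm 4 (toℕ i)) i+4≡j)
      (φᵥ-near (toℕ i) (n ∸ toℕ j))
  φ-near-inner {i} {j} (inj₂ i+4≡j+n) = φᵥ-near-wrap c+j≡4 12≤i 12≤n∸j
    where
    c+j≡4 : n ∸ toℕ i + toℕ j ≡ 4
    c+j≡4 = wrap-index i+4≡j+n (<⇒≤ (toℕ<n i))
    12≤i : 12 ≤ toℕ i
    12≤i = +-cancelʳ-≤ 4 12 (toℕ i)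
             (≤-trans (from-yes (16 ≤? n)) (≤-trans (m≤n+m n (toℕ j)) (≤-reflexive (sym i+4≡j+n))))
    12≤n∸j : 12 ≤ n ∸ toℕ j
    12≤n∸j = ≤-trans (from-yes (12 ≤? n ∸ 4))
               (∸-monoʳ-≤ n (≤-trans (m≤n+m (toℕ j) (n ∸ toℕ i)) (≤-reflexive c+j≡4)))

  φ-lipschitz : OneLipschitz {n} {4} φ
  φ-lipschitz (outer s)  = proj₁ (φ-near-outer s)
  φ-lipschitz (outer' s) = proj₂ (φ-near-outer s)
  φ-lipschitz (inner s)  = proj₁ (φ-near-inner s)
  φ-lipschitz (inner' s) = proj₂ (φ-near-inner s)
  φ-lipschitz {u i} spoke  = φᵤ≤1+φᵥ (toℕ i) (n ∸ toℕ i)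
  φ-lipschitz {v i} spoke' = φᵥ≤1+φᵤ (toℕ i) (n ∸ toℕ i)

  u₀ v₀ : Vertex n
  u₀ = u Fin.zero
  v₀ = v Fin.zero

  CloserToU₀ CloserToV₀ : Vertex n → Set
  CloserToU₀ = W n 4 u₀ v₀
  CloserToV₀ = W n 4 v₀ u₀

  closer-to-v₀ : ∀ {w L} → Walk n 4 w v₀ L → L < φ w → CloserToV₀ w
  closer-to-v₀ p = ∈W-by-potential φ-lipschitz refl p (p ∷ʳ spoke')

  not-closer-to-u₀ : ∀ {w L} → Walk n 4 w v₀ L → L ≤ φ w → ¬ CloserToU₀ w
  not-closer-to-u₀ p = ∉W-by-potential φ-lipschitz refl p

  interior-not-closer-to-u₀ : ∀ i → 3 ≤ toℕ i → 3 + toℕ i ≤ n → ¬ CloserToU₀ (u i)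
  interior-not-closer-to-u₀ i 3≤i 3+i≤n =
    not-closer-to-u₀ (walk-to-v₀ i (≤-trans (s≤s z≤n) 3≤i) (≤-trans (n≤1+n _) 3+i≤n))
                     (1+μ≤φᵤ 3≤i (m+n≤o⇒m≤o∸n 3 3+i≤n))

  interior-closer-to-v₀ : ∀ i → 4 ≤ toℕ i → 4 + toℕ i ≤ n → CloserToV₀ (u i)
  interior-closer-to-v₀ i 4≤i 4+i≤n =
    closer-to-v₀ (walk-to-v₀ i (≤-trans (s≤s z≤n) 4≤i) (≤-trans (≤-trans (n≤1+n _) (n≤1+n _)) 4+i≤n))
                 (2+μ≤φᵤ 4≤i (m+n≤o⇒m≤o∸n 4 4+i≤n))

  inner-closer-to-v₀ : ∀ {j t} → Walk n 4 (v j) v₀ t → t * 4 ≤ toℕ j → t * 4 ≤ n ∸ toℕ j →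
                       CloserToV₀ (v j)
  inner-closer-to-v₀ {t = t} p lo hi = closer-to-v₀ p (s≤s (⊓-glb (μ-lower t lo) (μ-lower t hi)))

  low-closer-to-v₀ : ∀ t {j} {t≤3 : True (t ≤? 3)} → toℕ j ≡ t * 4 → CloserToV₀ (v j)
  low-closer-to-v₀ t {j} {t≤3} j≡ =
    inner-closer-to-v₀ (inner-walk-down t j j≡) (≤-reflexive (sym j≡)) $ begin
    t * 4         ≤⟨ *-monoˡ-≤ 4 (toWitness t≤3) ⟩
    12            ≤⟨ from-yes (12 ≤? n ∸ 12) ⟩
    n ∸ 12        ≤⟨ ∸-monoʳ-≤ n (≤-trans (≤-reflexive j≡) (*-monoˡ-≤ 4 (toWitness t≤3))) ⟩
    n ∸ toℕ j     ∎
    where open ≤-Reasoning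

  high-closer-to-v₀ : ∀ t {j} {t≤2 : True (t ≤? 2)} → toℕ j ≡ n ∸ suc t * 4 → CloserToV₀ (v j)
  high-closer-to-v₀ t {j} {t≤2} j≡ =
    inner-closer-to-v₀ (inner-walk-up t j j+s≡n) s≤j (≤-reflexive (sym n∸j≡s))
    where
    open ≤-Reasoning
    s≤12 : suc t * 4 ≤ 12
    s≤12 = *-monoˡ-≤ 4 (s≤s (toWitness t≤2))
    s≤n : suc t * 4 ≤ n
    s≤n = ≤-trans s≤12 (from-yes (12 ≤? n))
    j+s≡n : toℕ j + suc t * 4 ≡ n
    j+s≡n = trans (cong (_+ suc t * 4) j≡) (m∸n+n≡m s≤n)
    n∸j≡s : n ∸ toℕ j ≡ suc t * 4
    n∸j≡s = trans (cong (n ∸_) j≡) (m∸[m∸n]≡n s≤n)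
    s≤j : suc t * 4 ≤ toℕ j
    s≤j = begin
      suc t * 4       ≤⟨ s≤12 ⟩
      12              ≤⟨ from-yes (12 ≤? n ∸ 12) ⟩
      n ∸ 12          ≤⟨ ∸-monoʳ-≤ n s≤12 ⟩
      n ∸ suc t * 4   ≡⟨ sym j≡ ⟩
      toℕ j           ∎

  -- v₀, v₄, v₈, v₁₂ and v₋₁₂, v₋₈, v₋₄ (opposite i is n − 1 − i); distinct because n ≥ 25.
  near-v₀ : List (Fin n)
  near-v₀ = # 0 ∷ # 4 ∷ # 8 ∷ # 12 ∷ opposite (# 11) ∷ opposite (# 7) ∷ opposite (# 3) ∷ []

  near-v₀-closer : All (CloserToV₀ ∘ v) near-v₀
  near-v₀-closer =
    low-closer-to-v₀ 0 refl ∷ low-closer-to-v₀ 1 refl ∷ low-closer-to-v₀ 2 refl ∷ low-closer-to-v₀ 3 refl ∷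
    high-closer-to-v₀ 2 (opposite-prop (# 11)) ∷ high-closer-to-v₀ 1 (opposite-prop (# 7)) ∷
    high-closer-to-v₀ 0 (opposite-prop (# 3)) ∷ []

  near-v₀-unique : Unique near-v₀
  near-v₀-unique = AllPairs.map Finₚ.<⇒≢ (Linked⇒AllPairs Finₚ.<-trans increasing)
    where
    increasing : Linked Fin._<_ near-v₀
    increasing =
      from-yes (0 <? 4) ∷ from-yes (4 <? 8) ∷ from-yes (8 <? 12) ∷
      subst (12 <_) (sym (opposite-prop (# 11))) (from-yes (12 <? n ∸ 12)) ∷
      subst₂ _<_ (sym (opposite-prop (# 11))) (sym (opposite-prop (# 7)))
             (+-monoˡ-< e (from-yes (13 <? 17))) ∷
      subst₂ _<_ (sym (opposite-prop (# 7))) (sym (opposite-prop (# 3)))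
             (+-monoˡ-< e (from-yes (17 <? 21))) ∷ [-]

  -- Opaque, because unifying against their unfolding would run the exhaustive search for walks.
  opaque
    CloserToU₀? : Decidable CloserToU₀
    CloserToU₀? w = W? (proj₂ (walk-to-u₀ w)) (proj₂ (walk-to-u₀ w) ∷ʳ spoke)

    CloserToV₀? : Decidable CloserToV₀
    CloserToV₀? w = W? (proj₂ (walk-to-u₀ w) ∷ʳ spoke) (proj₂ (walk-to-u₀ w))

  ∣outer-closer-to-u₀∣≤5 : ∣ select (CloserToU₀? ∘ u) ∣ ≤ 5
  ∣outer-closer-to-u₀∣≤5 =
    ≤-trans (p⊆q⇒∣p∣≤∣q∣ (∈-fromList⁺ ∘ in-rim ∘ ∈-select⁻ (CloserToU₀? ∘ u))) (∣fromList∣≤length (rim 2 2<n))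
    where
    2<n = from-yes (2 <? n)
    in-rim : ∀ {i} → CloserToU₀ (u i) → i ∈ₗ rim 2 2<n
    in-rim {i} closer =
      [ (λ i∈rim → i∈rim) , (λ (3≤i , 3+i≤n) → ⊥-elim (interior-not-closer-to-u₀ i 3≤i 3+i≤n closer)) ]′
        (rim-or-interior 2 2<n i)

  n≤7+∣outer-closer-to-v₀∣ : n ≤ 7 + ∣ select (CloserToV₀? ∘ u) ∣
  n≤7+∣outer-closer-to-v₀∣ = begin
    n                                   ≤⟨ m≤n+m∸n n 7 ⟩
    7 + (n ∸ 7)                         ≤⟨ +-monoʳ-≤ 7 (∸-monoʳ-≤ n (∣fromList∣≤length rim₃)) ⟩
    7 + (n ∸ ∣ fromList rim₃ ∣)          ≡⟨ cong (7 +_) (sym (∣∁p∣≡n∸∣p∣ (fromList rim₃))) ⟩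
    7 + ∣ ∁ (fromList rim₃) ∣            ≤⟨ +-monoʳ-≤ 7 (p⊆q⇒∣p∣≤∣q∣ outside-rim-closer) ⟩
    7 + ∣ select (CloserToV₀? ∘ u) ∣     ∎
    where
    open ≤-Reasoning
    3<n = from-yes (3 <? n)
    rim₃ = rim 3 3<n
    outside-rim-closer : ∁ (fromList rim₃) ⊆ select (CloserToV₀? ∘ u)
    outside-rim-closer {i} i∉rim = ∈-select⁺ (CloserToV₀? ∘ u)
      ([ (λ i∈rim → ⊥-elim (x∈∁p⇒x∉p i∉rim (∈-fromList⁺ i∈rim))) ,
         (λ (4≤i , 4+i≤n) → interior-closer-to-v₀ i 4≤i 4+i≤n) ]′ (rim-or-interior 3 3<n i))

  7≤∣inner-closer-to-v₀∣ : 7 ≤ ∣ select (CloserToV₀? ∘ v) ∣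
  7≤∣inner-closer-to-v₀∣ = ≤-trans (length≤∣fromList∣ near-v₀-unique)
    (p⊆q⇒∣p∣≤∣q∣ (∈-select⁺ (CloserToV₀? ∘ v) ∘ All.lookup near-v₀-closer ∘ ∈-fromList⁻ near-v₀))

  ∣inner-closer-to-u₀∣+∣inner-closer-to-v₀∣≤n : ∣ select (CloserToU₀? ∘ v) ∣ + ∣ select (CloserToV₀? ∘ v) ∣ ≤ n
  ∣inner-closer-to-u₀∣+∣inner-closer-to-v₀∣≤n = disjoint⇒∣p∣+∣q∣≤n λ i∈p i∈q →
    W-asym (∈-select⁻ (CloserToU₀? ∘ v) i∈p) (∈-select⁻ (CloserToV₀? ∘ v) i∈q)

  u₀v₀-distance : Dist n 4 u₀ v₀ 1
  u₀v₀-distance = spoke ∷ [] , λ { zero () ; (suc _) _ → s≤s z≤n }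

  not-1-distance-balanced : ¬ DistanceBalanced n 4 1
  not-1-distance-balanced balanced =
    unbalanced ∣outer-closer-to-u₀∣≤5 ∣inner-closer-to-u₀∣+∣inner-closer-to-v₀∣≤n
               n≤7+∣outer-closer-to-v₀∣ 7≤∣inner-closer-to-v₀∣
      (balanced u₀ v₀ u₀v₀-distance _ _ (hasCard CloserToU₀?) (hasCard CloserToV₀?))

proposition3p1 : ∀ (n : ℕ) → 24 < n → ¬ DistanceBalanced n 4 1
proposition3p1 n 24<n =
  subst (λ m → ¬ DistanceBalanced m 4 1) (m+[n∸m]≡n 24<n) (not-1-distance-balanced (n ∸ 25))
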